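{- Every (finite or infinite) half graph $\Gamma$ with $|V(\Gamma)|\geq 4$ is prime.
   Context: A module of a graph $\Gamma$ is a set $M\subseteq V(\Gamma)$ such that each vertex outside $M$ is adjacent to all or to none of the vertices of $M$; $\emptyset$, $V(\Gamma)$ and singletons are trivial modules. $\Gamma$ is prime if $|V(\Gamma)|\geq 3$ and all its modules are trivial. A bipartite graph $\Gamma$ with bipartition $\{X,Y\}$ is a half graph if there exist a linear order $L$ on $X$ and a bijection $\varphi:X\to Y$ such that $E(\Gamma)=\{\{x,\varphi(x')\}: x\leq x' \bmod L\}$. -}

module Defs where

open import Level using (0ℓ)
open import Data.Bool using (Bool; true; false)
open import Data.Fin using (Fin)
open import Data.Nat using (ℕ)
open import Data.Product using (Σ; Σ-syntax; _×_; proj₁)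
open import Data.Sum using (_⊎_)
open import Relation.Nullary using (¬_)
open import Relation.Binary.PropositionalEquality using (_≡_)
open import Relation.Binary.Structures using (IsTotalOrder)
open import Function.Bundles using (_⤖_; Bijection; _⇔_)
open import Function.Definitions using (Injective)
open import Axiom.ExcludedMiddle using (ExcludedMiddle) public

record Graph : Set₁ where
  field
    V     : Set
    Adj   : V → V → Set
    sym   : ∀ {u v} → Adj u v → Adj v u
    irrefl : ∀ {v} → ¬ Adj v v
open Graph public

AtLeast : ℕ → Set → Set
AtLeast n V = Σ (Fin n → V) (λ f → Injective _≡_ _≡_ f)

IsModule : (G : Graph) → (V G → Set) → Set
IsModule G M = ∀ v → ¬ M v →
  (∀ m → M m → Adj G v m) ⊎ (∀ m → M m → ¬ Adj G v m)

IsTrivial : (G : Graph) → (V G → Set) → Set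
IsTrivial G M =
  (∀ v → ¬ M v) ⊎ (∀ v → M v) ⊎ Σ (V G) (λ v → ∀ w → M w ⇔ (w ≡ v))

IsPrime : Graph → Set₁
IsPrime G = AtLeast 3 (V G) × (∀ (M : V G → Set) → IsModule G M → IsTrivial G M)

-- Half graph: a bipartition {X, Y} of V (X given by a Bool-valued indicator,
-- Y its complement), a linear order L on X and a bijection φ : X → Y with
-- E(Γ) = {{x, φ(x')} : x ≤ x' in L}.
module _ (G : Graph) (inX : V G → Bool) where
  XPart : Set
  XPart = Σ (V G) (λ v → inX v ≡ true)
  YPart : Set
  YPart = Σ (V G) (λ v → inX v ≡ false)

  HalfGraphData : (_≤_ : XPart → XPart → Set) → (XPart ⤖ YPart) → Set
  HalfGraphData _≤_ φ =
    IsTotalOrder _≡_ _≤_ ×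
    (∀ u v → Adj G u v ⇔
       (Σ[ x ∈ XPart ] Σ[ x' ∈ XPart ] (x ≤ x' ×
          ((u ≡ proj₁ x × v ≡ proj₁ (Bijection.to φ x'))
         ⊎ (v ≡ proj₁ x × u ≡ proj₁ (Bijection.to φ x'))))))

IsHalfGraph : Graph → Set₁
IsHalfGraph G =
  Σ[ inX ∈ (V G → Bool) ] Σ[ le ∈ (XPart G inX → XPart G inX → Set) ]
  Σ[ φ ∈ (XPart G inX ⤖ YPart G inX) ] HalfGraphData G inX le φ

{-# OPTIONS --safe #-}
module Submission where

open import Defs
open import Level using (0ℓ)
open import Axiom.UniquenessOfIdentityProofs using (module Decidable⇒UIP)
open import Data.Bool using (Bool; true; false; _≟_)
open import Data.Fin using (inject≤)
open import Data.Fin.Properties using (inject≤-injective)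
open import Data.Nat using (_≤_; s≤s; z≤n)
open import Data.Product using (Σ; proj₁; proj₂; _,_; _×_)
open import Data.Sum using (_⊎_; inj₁; inj₂)
open import Data.Empty using (⊥-elim)
open import Relation.Nullary using (¬_; yes; no)
open import Relation.Binary.PropositionalEquality using (_≡_; _≢_; refl; trans; cong)
  renaming (sym to ≡-sym)
open import Relation.Binary.Structures using (IsTotalOrder)
open import Function.Bundles using (_⤖_; Bijection; _⇔_; mk⇔; Equivalence)

-- A vertex adjacent to one member of a module but not to another lies in the
-- module. In a half graph this forces every module with two distinct members
-- to be everything: from x ∈ X and y ∈ Y in M, the module grows upwards along
-- the order in Y and downwards in X until it covers both sides, and two
-- distinct members on the same side are separated by a vertex of the other
-- side, which reduces to the mixed case. The bound |V(Γ)| ≥ 4 is only needed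
-- for the clause |V(Γ)| ≥ 3 of primality.

AtLeast-mono : ∀ {m n} {A : Set} → m ≤ n → AtLeast n A → AtLeast m A
AtLeast-mono m≤n (f , f-injective) =
  (λ i → f (inject≤ i m≤n)) , λ e → inject≤-injective m≤n m≤n _ _ (f-injective e)

fibre-proj₁-injective : {A : Set} {f : A → Bool} {b : Bool} {p q : Σ A (λ a → f a ≡ b)} →
                        proj₁ p ≡ proj₁ q → p ≡ q
fibre-proj₁-injective {p = a , e} {q = .a , e′} refl =
  cong (a ,_) (Decidable⇒UIP.≡-irrelevant _≟_ e e′)

module _ (lem : ExcludedMiddle 0ℓ) (G : Graph) {M : V G → Set} where

  module-absorbs-splitter : IsModule G M → ∀ {u v w} →
                            M u → M v → Adj G w u → ¬ Adj G w v → M w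
  module-absorbs-splitter isModule {u} {v} {w} u∈M v∈M w~u w≁v with lem {M w}
  ... | yes w∈M = w∈M
  ... | no w∉M with isModule w w∉M
  ...   | inj₁ adjacent-to-all  = ⊥-elim (w≁v (adjacent-to-all v v∈M))
  ...   | inj₂ adjacent-to-none = ⊥-elim (adjacent-to-none u u∈M w~u)

  trivial-if-pairs-span : (∀ {u v} → M u → M v → u ≢ v → ∀ w → M w) → IsTrivial G M
  trivial-if-pairs-span pair-spans with lem {Σ (V G) M}
  ... | no empty = inj₁ (λ v v∈M → empty (v , v∈M))
  ... | yes (v , v∈M) with lem {Σ (V G) λ w → M w × w ≢ v}
  ...   | yes (w , w∈M , w≢v) = inj₂ (inj₁ (pair-spans w∈M v∈M w≢v))
  ...   | no only-v = inj₂ (inj₂ (v , λ w → mk⇔ (member≡v w) (λ { refl → v∈M })))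
    where
    member≡v : ∀ w → M w → w ≡ v
    member≡v w w∈M with lem {w ≡ v}
    ... | yes w≡v = w≡v
    ... | no w≢v = ⊥-elim (only-v (w , w∈M , w≢v))

module HalfGraph (G : Graph) (inX : V G → Bool)
  (_≼_ : XPart G inX → XPart G inX → Set) (φ : XPart G inX ⤖ YPart G inX)
  (halfGraph : HalfGraphData G inX _≼_ φ) where

  X : Set
  X = XPart G inX

  open Bijection φ using (injective; surjective) renaming (to to φ⟨_⟩)
  open Σ halfGraph renaming (proj₁ to isTotalOrder; proj₂ to edges)
  open IsTotalOrder isTotalOrder using (total; antisym; reflexive)

  ≼-refl : ∀ {a} → a ≼ a
  ≼-refl = reflexive refl

  x y : X → V G
  x a = proj₁ a
  y a = proj₁ φ⟨ a ⟩

  y-injective : ∀ {a b} → y a ≡ y b → a ≡ b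
  y-injective e = injective (fibre-proj₁-injective e)

  x≢y : ∀ a b → x a ≢ y b
  x≢y a b e with trans (≡-sym (proj₂ a)) (trans (cong inX e) (proj₂ φ⟨ b ⟩))
  ... | ()

  x~y⇔≼ : ∀ {a c} → Adj G (x a) (y c) ⇔ a ≼ c
  x~y⇔≼ {a} {c} = mk⇔ to from
    where
    from : a ≼ c → Adj G (x a) (y c)
    from a≼c = Equivalence.from (edges (x a) (y c)) (a , c , a≼c , inj₁ (refl , refl))

    to : Adj G (x a) (y c) → a ≼ c
    to x~y with Equivalence.to (edges (x a) (y c)) x~y
    ... | a′ , c′ , a′≼c′ , inj₁ (a≡a′ , c≡c′)
      rewrite fibre-proj₁-injective {p = a} {q = a′} a≡a′ | y-injective {c} {c′} c≡c′ = a′≼c′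
    ... | a′ , _ , _ , inj₂ (y≡a′ , _) = ⊥-elim (x≢y a′ c (≡-sym y≡a′))

  y~x : ∀ {a c} → a ≼ c → Adj G (y c) (x a)
  y~x a≼c = Graph.sym G (Equivalence.from x~y⇔≼ a≼c)

  x≁x : ∀ a b → ¬ Adj G (x a) (x b)
  x≁x a b x~x with Equivalence.to (edges (x a) (x b)) x~x
  ... | _ , c , _ , inj₁ (_ , b≡y) = x≢y b c b≡y
  ... | _ , c , _ , inj₂ (_ , a≡y) = x≢y a c a≡y

  y≁y : ∀ a b → ¬ Adj G (y a) (y b)
  y≁y a b y~y with Equivalence.to (edges (y a) (y b)) y~y
  ... | c , _ , _ , inj₁ (a≡x , _) = x≢y c a (≡-sym a≡x)
  ... | c , _ , _ , inj₂ (b≡x , _) = x≢y c b (≡-sym b≡x)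

  vertex-cases : ∀ v → Σ X (λ a → v ≡ x a) ⊎ Σ X (λ a → v ≡ y a)
  vertex-cases v with inX v in v∈X
  ... | true  = inj₁ ((v , v∈X) , refl)
  ... | false with surjective (v , v∈X)
  ...   | a , φa≡v = inj₂ (a , ≡-sym (cong proj₁ (φa≡v refl)))

  module _ (lem : ExcludedMiddle 0ℓ) {M : V G → Set} (isModule : IsModule G M) where

    absorb : ∀ {u v w} → M u → M v → Adj G w u → ¬ Adj G w v → M w
    absorb = module-absorbs-splitter lem G isModule

    y-upward : ∀ {a c} b → a ≼ c → M (x a) → M (y b) → M (y c)
    y-upward {c = c} b a≼c xa∈M yb∈M = absorb xa∈M yb∈M (y~x a≼c) (y≁y c b)

    x-downward : ∀ {b c} a → c ≼ b → M (x a) → M (y b) → M (x c)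
    x-downward {c = c} a c≼b xa∈M yb∈M =
      absorb yb∈M xa∈M (Equivalence.from x~y⇔≼ c≼b) (x≁x c a)

    xy-pair-covers : ∀ a b → M (x a) → M (y b) → ∀ c → M (x c) × M (y c)
    xy-pair-covers a b xa∈M yb∈M c with total a c
    ... | inj₁ a≼c = x-downward a ≼-refl xa∈M yc∈M , yc∈M
      where
      yc∈M : M (y c)
      yc∈M = y-upward b a≼c xa∈M yb∈M
    ... | inj₂ c≼a = xc∈M , y-upward a ≼-refl xc∈M ya∈M
      where
      ya∈M : M (y a)
      ya∈M = y-upward b ≼-refl xa∈M yb∈M
      xc∈M : M (x c)
      xc∈M = x-downward a c≼a xa∈M ya∈M

    xy-pair-spans : ∀ a b → M (x a) → M (y b) → ∀ v → M v
    xy-pair-spans a b xa∈M yb∈M v with vertex-cases v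
    ... | inj₁ (c , refl) = proj₁ (xy-pair-covers a b xa∈M yb∈M c)
    ... | inj₂ (c , refl) = proj₂ (xy-pair-covers a b xa∈M yb∈M c)

    xx-pair-spans : ∀ {a b} → a ≼ b → a ≢ b → M (x a) → M (x b) → ∀ v → M v
    xx-pair-spans {a} {b} a≼b a≢b xa∈M xb∈M =
      xy-pair-spans a a xa∈M (absorb xa∈M xb∈M (y~x ≼-refl) ya≁xb)
      where
      ya≁xb : ¬ Adj G (y a) (x b)
      ya≁xb ya~xb = a≢b (antisym a≼b (Equivalence.to x~y⇔≼ (Graph.sym G ya~xb)))

    yy-pair-spans : ∀ {a b} → a ≼ b → a ≢ b → M (y a) → M (y b) → ∀ v → M v
    yy-pair-spans {a} {b} a≼b a≢b ya∈M yb∈M =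
      xy-pair-spans b b (absorb yb∈M ya∈M (Equivalence.from x~y⇔≼ ≼-refl) xb≁ya) yb∈M
      where
      xb≁ya : ¬ Adj G (x b) (y a)
      xb≁ya xb~ya = a≢b (antisym a≼b (Equivalence.to x~y⇔≼ xb~ya))

    pair-spans : ∀ {u v} → M u → M v → u ≢ v → ∀ w → M w
    pair-spans {u} {v} u∈M v∈M u≢v with vertex-cases u | vertex-cases v
    ... | inj₁ (a , refl) | inj₂ (b , refl) = xy-pair-spans a b u∈M v∈M
    ... | inj₂ (a , refl) | inj₁ (b , refl) = xy-pair-spans b a v∈M u∈M
    ... | inj₁ (a , refl) | inj₁ (b , refl) with total a b
    ...   | inj₁ a≼b = xx-pair-spans a≼b (λ a≡b → u≢v (cong x a≡b)) u∈M v∈M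
    ...   | inj₂ b≼a = xx-pair-spans b≼a (λ b≡a → u≢v (cong x (≡-sym b≡a))) v∈M u∈M
    pair-spans {u} {v} u∈M v∈M u≢v | inj₂ (a , refl) | inj₂ (b , refl) with total a b
    ...   | inj₁ a≼b = yy-pair-spans a≼b (λ a≡b → u≢v (cong y a≡b)) u∈M v∈M
    ...   | inj₂ b≼a = yy-pair-spans b≼a (λ b≡a → u≢v (cong y (≡-sym b≡a))) v∈M u∈M

corollary5p6 : ExcludedMiddle 0ℓ → (G : Graph) → IsHalfGraph G → AtLeast 4 (V G) → IsPrime G
corollary5p6 lem G (inX , _≼_ , φ , halfGraph) four-vertices =
  AtLeast-mono (s≤s (s≤s (s≤s z≤n))) four-vertices ,
  λ M isModule → trivial-if-pairs-span lem G (pair-spans lem isModule)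
  where open HalfGraph G inX _≼_ φ halfGraph
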